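{- Fix a constant $c>0$. For all sufficiently large $d$ and all integers $t$ with $\left(\frac{c\log d}{d^{1/3}}\right)2^{d-1}\le t\le \frac34 2^{d-1}$, setting $$ f=\max\left\{d,\ 5^7e\,t\left(1-\frac{t}{2^{d-1}}\right)^{d-1}\right\}, $$ we have $$ i_t(Q_d)\ge 2\sum_{A\subseteq\mathcal E,\ \mathrm{cl}(A)\le1,\ |A|\le f}\binom{2^{d-1}-d|A|}{t-|A|}. $$
   Context: $Q_d$ is the graph on vertex set $\{0,1\}^d$ with two strings adjacent iff they differ in exactly one coordinate; $\mathcal E$ is the set of vertices with an even number of 1's. $i_t(Q_d)$ is the number of independent sets of $Q_d$ of size exactly $t$. For $A\subseteq V$, $N(A)$ is the set of vertices outside $A$ adjacent to some vertex of $A$. A set $A\subseteq\mathcal E$ is 2-linked if $A\cup N(A)$ induces a connected subgraph of $Q_d$; the 2-components of $A$ are its maximal 2-linked subsets, and $\mathrm{cl}(A)$ is the size of the largest 2-component of $A$ (so $\mathrm{cl}(A)\le 1$ means no two vertices of $A$ have a common neighbour; $\mathrm{cl}(\emptyset)=0$). $\log=\log_2$. -}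

module Defs where

open import Data.Bool using (Bool; true; false; not; _∧_; _∨_; if_then_else_)
open import Data.Nat using (ℕ; zero; suc; _+_; _*_; _∸_; _^_; _≤_; _<_; _≡ᵇ_; _≤ᵇ_; _!)
open import Data.Nat.Combinatorics using (_C_)
open import Data.List using (List; []; _∷_; [_]; _++_; map; length; filterᵇ)
open import Data.Bool.ListAction using (any)
open import Data.Nat.ListAction using (sum)
open import Data.Vec using (Vec; []; _∷_)
open import Data.Product using (∃-syntax; _×_)
open import Data.Sum using (_⊎_)
open import Relation.Nullary using (¬_)

allVertices : (d : ℕ) → List (Vec Bool d)
allVertices zero    = [ [] ]
allVertices (suc d) = map (false ∷_) (allVertices d) ++ map (true ∷_) (allVertices d)

dist : {d : ℕ} → Vec Bool d → Vec Bool d → ℕ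
dist []       []       = 0
dist (x ∷ xs) (y ∷ ys) = (if (x ∧ not y) ∨ (y ∧ not x) then 1 else 0) + dist xs ys

adjᵇ : {d : ℕ} → Vec Bool d → Vec Bool d → Bool
adjᵇ u v = dist u v ≡ᵇ 1

ones : {d : ℕ} → Vec Bool d → ℕ
ones []           = 0
ones (true ∷ xs)  = suc (ones xs)
ones (false ∷ xs) = ones xs

evenᵇ : ℕ → Bool
evenᵇ zero          = true
evenᵇ (suc zero)    = false
evenᵇ (suc (suc n)) = evenᵇ n

evenVertices : (d : ℕ) → List (Vec Bool d)
evenVertices d = filterᵇ (λ v → evenᵇ (ones v)) (allVertices d)

-- all sublists = all subsets of a duplicate-free list (each once)
subsets : {A : Set} → List A → List (List A)
subsets []       = [ [] ]
subsets (x ∷ xs) = subsets xs ++ map (x ∷_) (subsets xs)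

independentᵇ : {d : ℕ} → List (Vec Bool d) → Bool
independentᵇ []       = true
independentᵇ (x ∷ xs) = not (any (adjᵇ x) xs) ∧ independentᵇ xs

iₜ : (d t : ℕ) → ℕ
iₜ d t = length (filterᵇ (λ S → (length S ≡ᵇ t) ∧ independentᵇ S) (subsets (allVertices d)))

commonNbrᵇ : {d : ℕ} → Vec Bool d → Vec Bool d → Bool
commonNbrᵇ {d} u v = any (λ w → adjᵇ u w ∧ adjᵇ v w) (allVertices d)

-- cl(A) ≤ 1 : no two (distinct) vertices of A have a common neighbour
clLe1ᵇ : {d : ℕ} → List (Vec Bool d) → Bool
clLe1ᵇ []       = true
clLe1ᵇ (x ∷ xs) = not (any (commonNbrᵇ x) xs) ∧ clLe1ᵇ xs

-- N = 2^{d-1} = |ℰ|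
N : ℕ → ℕ
N d = 2 ^ (d ∸ 1)

-- binomial (2^{d-1} - d a choose t - a), taken to be 0 when the bottom
-- t - a is negative or the top 2^{d-1} - d a is negative
binomTerm : (d t a : ℕ) → ℕ
binomTerm d t a = if (a ≤ᵇ t) ∧ (d * a ≤ᵇ N d) then (N d ∸ d * a) C (t ∸ a) else 0

sumTerm : (d t m : ℕ) → ℕ
sumTerm d t m =
  sum (map (λ A → binomTerm d t (length A))
           (filterᵇ (λ A → clLe1ᵇ A ∧ (length A ≤ᵇ m)) (subsets (evenVertices d))))

-- eNum n = n! * Σ_{j=0}^{n} 1/j!  (so S_n = eNum n / n! are the partial sums of e)
eNum : ℕ → ℕ
eNum zero    = 1
eNum (suc n) = suc n * eNum n + 1

-- k ≤ 5^7 e t (1 - t/N)^{d-1}  (for natural k, with t ≤ N).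
-- Since e = sup_n S_n, S_n < e, and e is irrational, for rational X ≥ 0:
--   k ≤ e X  ⇔  ∃ n. k ≤ S_n X.  Cleared of denominators (N^{d-1}, n!):
LeEX : (d t k : ℕ) → Set
LeEX d t k = ∃[ n ] (k * (n !) * N d ^ (d ∸ 1) ≤ 5 ^ 7 * t * (N d ∸ t) ^ (d ∸ 1) * eNum n)

LeF : (d t k : ℕ) → Set
LeF d t k = k ≤ d ⊎ LeEX d t k

-- m = ⌊f⌋  (|A| ≤ f  ⇔  |A| ≤ ⌊f⌋)
IsFloorF : (d t m : ℕ) → Set
IsFloorF d t m = LeF d t m × ¬ LeF d t (suc m)

-- (c log₂ d / d^{1/3}) 2^{d-1} ≤ t  with c = p/q, i.e.  c N log₂ d ≤ t d^{1/3}.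
-- Expressed via rationals r = a/b < log₂ d (⇔ 2^a < d^b):
--   c N log₂ d ≤ t d^{1/3}  ⇔  ∀ such r ≥ 0:  (c r N)^3 ≤ t^3 d.
LowerBound : (p q d t : ℕ) → Set
LowerBound p q d t =
  (a b : ℕ) → 0 < b → 2 ^ a < d ^ b → (p * a * N d) ^ 3 ≤ (q * b * t) ^ 3 * d

-- A set A of even vertices with |A| ≤ m has at most d|A| neighbours, so at least
-- C(2^(d-1) - d|A|, t - |A|) sets B of t - |A| odd vertices avoid N(A), and each
-- A ∪ B is an independent t-set.  Exchanging the two sides gives a second such
-- family, and when 2m < t the two are disjoint: the side meeting the set in at
-- most m vertices is then determined.  The condition cl(A) ≤ 1 only shrinks the
-- sum.  It remains to see 2⌊f⌋ < t for large d.  The lower bound on t, used only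
-- through log₂ d > 1, gives t ≥ 12·5^7·2^(d-1)/(d-1) > 2d; and since e < 3 and
-- (1 - x)^(d-1) (1 + (d-1)x) ≤ 1, the second term of f is at most
-- 3·5^7·2^(d-1)/(d-1) ≤ t/4.
{-# OPTIONS --safe #-}
module Submission where

open import Data.Bool using (Bool; true; false; not; _∧_; _∨_; if_then_else_; _xor_)
open import Data.Bool.Properties
  using (T-≡; not-involutive; not-injective; xor-same; not-distribˡ-xor; not-distribʳ-xor;
         ∧-zeroʳ; ∧-conicalˡ; ∧-conicalʳ)
open import Data.Bool.ListAction using (any; all)
open import Data.Empty using (⊥; ⊥-elim)
open import Data.List using (List; []; _∷_; _++_; map; length; filterᵇ)
open import Data.List.Properties using (map-++; map-∘; map-cong; filter-++; length-++; length-map)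
open import Data.Nat
open import Data.Nat.Combinatorics using (_C_; nCk+nC[k+1]≡[n+1]C[k+1]; nC1≡n)
open import Data.Nat.ListAction using (sum)
open import Data.Nat.ListAction.Properties using (sum-++)
open import Data.Nat.Properties
open import Algebra.Properties.CommutativeSemigroup +-commutativeSemigroup
  using () renaming (interchange to +-interchange)
open import Algebra.Properties.CommutativeSemigroup *-commutativeSemigroup
  using (x∙yz≈y∙xz; xy∙z≈y∙xz; xy∙z≈xz∙y; x∙yz≈xz∙y) renaming (interchange to *-interchange)
open import Data.Nat.Tactic.RingSolver using (solve-∀)
open import Data.Product using (∃-syntax; _×_; _,_)
open import Data.Sum using (inj₁; inj₂)
open import Data.Vec using (Vec; []; _∷_)
open import Function using (_∘_; Equivalence)
open import Relation.Binary.PropositionalEquality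
open import Relation.Nullary using (yes; no; contradiction)
open import Relation.Nullary.Decidable using (T?)
open import Defs

private variable
  X Y : Set

-- Sums and counts over lists

⟦_⟧ : Bool → ℕ
⟦ true ⟧  = 1
⟦ false ⟧ = 0

if-≤ : ∀ b {x y} → (b ≡ true → x ≤ y) → (if b then x else 0) ≤ y
if-≤ true  x≤y = x≤y refl
if-≤ false x≤y = z≤n

≤-if : ∀ {b x} → b ≡ true → x ≤ (if b then x else 0)
≤-if refl = ≤-refl

⟦⟧+⟦⟧≤⟦⟧ : ∀ {a b c} → (a ≡ true → b ≡ true → ⊥) → (a ≡ true → c ≡ true) → (b ≡ true → c ≡ true) →
           ⟦ a ⟧ + ⟦ b ⟧ ≤ ⟦ c ⟧
⟦⟧+⟦⟧≤⟦⟧ {true}  {true}  a#b _   _   = ⊥-elim (a#b refl refl)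
⟦⟧+⟦⟧≤⟦⟧ {true}  {false} _   a⇒c _   rewrite a⇒c refl = ≤-refl
⟦⟧+⟦⟧≤⟦⟧ {false} {true}  _   _   b⇒c rewrite b⇒c refl = ≤-refl
⟦⟧+⟦⟧≤⟦⟧ {false} {false} _   _   _   = z≤n

∑ : List X → (X → ℕ) → ℕ
∑ xs f = sum (map f xs)

syntax ∑ xs (λ x → e) = ∑[ x ∈ xs ] e

∑-++ : (xs ys : List X) (f : X → ℕ) → ∑ (xs ++ ys) f ≡ ∑ xs f + ∑ ys f
∑-++ xs ys f = trans (cong sum (map-++ f xs ys)) (sum-++ (map f xs) (map f ys))

∑-map : (g : X → Y) (xs : List X) (f : Y → ℕ) → ∑ (map g xs) f ≡ ∑ xs (f ∘ g)
∑-map g xs f = cong sum (sym (map-∘ xs))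

∑-cong : (xs : List X) {f g : X → ℕ} → (∀ x → f x ≡ g x) → ∑ xs f ≡ ∑ xs g
∑-cong xs f≗g = cong sum (map-cong f≗g xs)

∑-mono-≤ : (xs : List X) {f g : X → ℕ} → (∀ x → f x ≤ g x) → ∑ xs f ≤ ∑ xs g
∑-mono-≤ []       f≤g = z≤n
∑-mono-≤ (x ∷ xs) f≤g = +-mono-≤ (f≤g x) (∑-mono-≤ xs f≤g)

∑-distrib-+ : (xs : List X) (f g : X → ℕ) → ∑[ x ∈ xs ] (f x + g x) ≡ ∑ xs f + ∑ xs g
∑-distrib-+ []       f g = refl
∑-distrib-+ (x ∷ xs) f g =
  trans (cong (f x + g x +_) (∑-distrib-+ xs f g)) (+-interchange (f x) (g x) _ _)

∑-zero : (xs : List X) → ∑[ x ∈ xs ] 0 ≡ 0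
∑-zero []       = refl
∑-zero (x ∷ xs) = ∑-zero xs

∑-comm : (xs : List X) (ys : List Y) (h : X → Y → ℕ) →
         ∑[ x ∈ xs ] ∑[ y ∈ ys ] h x y ≡ ∑[ y ∈ ys ] ∑[ x ∈ xs ] h x y
∑-comm []       ys h = sym (∑-zero ys)
∑-comm (x ∷ xs) ys h =
  trans (cong (∑ ys (h x) +_) (∑-comm xs ys h)) (sym (∑-distrib-+ ys (h x) _))

∑-filterᵇ : (p : X → Bool) (xs : List X) (f : X → ℕ) →
            ∑ (filterᵇ p xs) f ≡ ∑[ x ∈ xs ] (if p x then f x else 0)
∑-filterᵇ p []       f = refl
∑-filterᵇ p (x ∷ xs) f with p x
... | true  = cong (f x +_) (∑-filterᵇ p xs f)
... | false = ∑-filterᵇ p xs f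

filterᵇ-accept : (p : X → Bool) {x : X} (xs : List X) →
                 p x ≡ true → filterᵇ p (x ∷ xs) ≡ x ∷ filterᵇ p xs
filterᵇ-accept p xs px rewrite px = refl

filterᵇ-reject : (p : X → Bool) {x : X} (xs : List X) →
                 p x ≡ false → filterᵇ p (x ∷ xs) ≡ filterᵇ p xs
filterᵇ-reject p xs ¬px rewrite ¬px = refl

count : (X → Bool) → List X → ℕ
count p xs = length (filterᵇ p xs)

count≡∑ : (p : X → Bool) (xs : List X) → count p xs ≡ ∑[ x ∈ xs ] ⟦ p x ⟧
count≡∑ p []       = refl
count≡∑ p (x ∷ xs) with p x
... | true  = cong suc (count≡∑ p xs)
... | false = count≡∑ p xs

count-cong : (xs : List X) {p q : X → Bool} → (∀ x → p x ≡ q x) → count p xs ≡ count q xs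
count-cong xs p≗q = trans (count≡∑ _ xs) (trans (∑-cong xs (cong ⟦_⟧ ∘ p≗q)) (sym (count≡∑ _ xs)))

count-false : (xs : List X) → count (λ _ → false) xs ≡ 0
count-false []       = refl
count-false (x ∷ xs) = count-false xs

count-++ : (p : X → Bool) (xs ys : List X) → count p (xs ++ ys) ≡ count p xs + count p ys
count-++ p xs ys = trans (cong length (filter-++ (T? ∘ p) xs ys)) (length-++ (filterᵇ p xs))

count-map : (p : Y → Bool) (g : X → Y) (xs : List X) → count p (map g xs) ≡ count (p ∘ g) xs
count-map p g xs = trans (count≡∑ p (map g xs)) (trans (∑-map g xs _) (sym (count≡∑ (p ∘ g) xs)))

count+count-not : (p : X → Bool) (xs : List X) → count p xs + count (not ∘ p) xs ≡ length xs
count+count-not p []       = refl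
count+count-not p (x ∷ xs) with p x
... | true  = cong suc (count+count-not p xs)
... | false = trans (+-suc _ _) (cong suc (count+count-not p xs))

count-∨ : (p q : X → Bool) (xs : List X) →
          count (λ x → p x ∨ q x) xs ≤ count p xs + count q xs
count-∨ p q xs = begin
  count (λ x → p x ∨ q x) xs                ≡⟨ count≡∑ _ xs ⟩
  ∑[ x ∈ xs ] ⟦ p x ∨ q x ⟧                 ≤⟨ ∑-mono-≤ xs (λ x → ⟦∨⟧≤ (p x) (q x)) ⟩
  ∑[ x ∈ xs ] (⟦ p x ⟧ + ⟦ q x ⟧)           ≡⟨ ∑-distrib-+ xs _ _ ⟩
  ∑[ x ∈ xs ] ⟦ p x ⟧ + ∑[ x ∈ xs ] ⟦ q x ⟧ ≡⟨ cong₂ _+_ (count≡∑ p xs) (count≡∑ q xs) ⟨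
  count p xs + count q xs                   ∎
  where
  open ≤-Reasoning
  ⟦∨⟧≤ : ∀ a b → ⟦ a ∨ b ⟧ ≤ ⟦ a ⟧ + ⟦ b ⟧
  ⟦∨⟧≤ true  b = s≤s z≤n
  ⟦∨⟧≤ false b = ≤-refl

count-filterᵇ-≤ : (p q : X → Bool) (xs : List X) → count p (filterᵇ q xs) ≤ count p xs
count-filterᵇ-≤ p q xs = begin
  count p (filterᵇ q xs)                      ≡⟨ count≡∑ p (filterᵇ q xs) ⟩
  ∑ (filterᵇ q xs) (⟦_⟧ ∘ p)                  ≡⟨ ∑-filterᵇ q xs _ ⟩
  ∑[ x ∈ xs ] (if q x then ⟦ p x ⟧ else 0)    ≤⟨ ∑-mono-≤ xs (λ x → if-≤ (q x) (λ _ → ≤-refl)) ⟩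
  ∑[ x ∈ xs ] ⟦ p x ⟧                         ≡⟨ count≡∑ p xs ⟨
  count p xs                                  ∎
  where open ≤-Reasoning

all-const-true : (xs : List X) → all (λ _ → true) xs ≡ true
all-const-true []       = refl
all-const-true (x ∷ xs) = all-const-true xs

not-any : (p : X → Bool) (xs : List X) → not (any p xs) ≡ all (not ∘ p) xs
not-any p []       = refl
not-any p (x ∷ xs) with p x
... | true  = refl
... | false = not-any p xs

all-cong : (xs : List X) {p q : X → Bool} → (∀ x → p x ≡ q x) → all p xs ≡ all q xs
all-cong []       p≗q = refl
all-cong (x ∷ xs) p≗q = cong₂ _∧_ (p≗q x) (all-cong xs p≗q)

any≡false-by-filterᵇ : (p f : X → Bool) → (∀ y → p y ≡ false → f y ≡ false) →
                       (S : List X) → all (not ∘ f) (filterᵇ p S) ≡ true → any f S ≡ false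
any≡false-by-filterᵇ p f f-off []      _ = refl
any≡false-by-filterᵇ p f f-off (y ∷ S) h with p y in py
... | false rewrite f-off y py = any≡false-by-filterᵇ p f f-off S h
... | true with f y
...   | false = any≡false-by-filterᵇ p f f-off S h

≡ᵇ-shift : ∀ {a t} b → a ≤ t → (a + b ≡ᵇ t) ≡ (b ≡ᵇ t ∸ a)
≡ᵇ-shift b z≤n       = refl
≡ᵇ-shift b (s≤s a≤t) = ≡ᵇ-shift b a≤t

-- Sums over subsets

∑-subsets-∷ : (x : X) (xs : List X) (f : List X → ℕ) →
              ∑ (subsets (x ∷ xs)) f ≡ ∑ (subsets xs) f + ∑[ S ∈ subsets xs ] f (x ∷ S)
∑-subsets-∷ x xs f =
  trans (∑-++ (subsets xs) _ f) (cong (∑ (subsets xs) f +_) (∑-map (x ∷_) (subsets xs) f))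

module _ (q : X → Bool) where

  ∑-subsets-partition :
    (xs : List X) (h : List X → List X → ℕ) →
    ∑[ S ∈ subsets xs ] h (filterᵇ q S) (filterᵇ (not ∘ q) S) ≡
    ∑[ A ∈ subsets (filterᵇ q xs) ] ∑[ B ∈ subsets (filterᵇ (not ∘ q) xs) ] h A B
  ∑-subsets-partition []       h = sym (+-identityʳ _)
  ∑-subsets-partition (x ∷ xs) h with q x in qx
  ... | true = begin
    ∑ (subsets (x ∷ xs)) H
      ≡⟨ ∑-subsets-∷ x xs H ⟩
    ∑ (subsets xs) H + ∑[ S ∈ subsets xs ] H (x ∷ S)
      ≡⟨ cong (∑ (subsets xs) H +_) (∑-cong (subsets xs) λ S →
           cong₂ h (filterᵇ-accept q S qx) (filterᵇ-reject (not ∘ q) S (cong not qx))) ⟩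
    ∑ (subsets xs) H + ∑[ S ∈ subsets xs ] h (x ∷ filterᵇ q S) (filterᵇ (not ∘ q) S)
      ≡⟨ cong₂ _+_ (∑-subsets-partition xs h) (∑-subsets-partition xs (h ∘ (x ∷_))) ⟩
    ∑[ A ∈ subsets Q ] ∑[ B ∈ subsets Q̅ ] h A B + ∑[ A ∈ subsets Q ] ∑[ B ∈ subsets Q̅ ] h (x ∷ A) B
      ≡⟨ ∑-subsets-∷ x Q (λ A → ∑[ B ∈ subsets Q̅ ] h A B) ⟨
    ∑[ A ∈ subsets (x ∷ Q) ] ∑[ B ∈ subsets Q̅ ] h A B ∎
    where
    open ≡-Reasoning
    Q = filterᵇ q xs
    Q̅ = filterᵇ (not ∘ q) xs
    H : List X → ℕ
    H S = h (filterᵇ q S) (filterᵇ (not ∘ q) S)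
  ... | false = begin
    ∑ (subsets (x ∷ xs)) H
      ≡⟨ ∑-subsets-∷ x xs H ⟩
    ∑ (subsets xs) H + ∑[ S ∈ subsets xs ] H (x ∷ S)
      ≡⟨ cong (∑ (subsets xs) H +_) (∑-cong (subsets xs) λ S →
           cong₂ h (filterᵇ-reject q S qx) (filterᵇ-accept (not ∘ q) S (cong not qx))) ⟩
    ∑ (subsets xs) H + ∑[ S ∈ subsets xs ] h (filterᵇ q S) (x ∷ filterᵇ (not ∘ q) S)
      ≡⟨ cong₂ _+_ (∑-subsets-partition xs h) (∑-subsets-partition xs (λ A → h A ∘ (x ∷_))) ⟩
    ∑[ A ∈ subsets Q ] ∑[ B ∈ subsets Q̅ ] h A B + ∑[ A ∈ subsets Q ] ∑[ B ∈ subsets Q̅ ] h A (x ∷ B)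
      ≡⟨ ∑-distrib-+ (subsets Q) _ _ ⟨
    ∑[ A ∈ subsets Q ] (∑[ B ∈ subsets Q̅ ] h A B + ∑[ B ∈ subsets Q̅ ] h A (x ∷ B))
      ≡⟨ ∑-cong (subsets Q) (λ A → ∑-subsets-∷ x Q̅ (h A)) ⟨
    ∑[ A ∈ subsets Q ] ∑[ B ∈ subsets (x ∷ Q̅) ] h A B ∎
    where
    open ≡-Reasoning
    Q = filterᵇ q xs
    Q̅ = filterᵇ (not ∘ q) xs
    H : List X → ℕ
    H S = h (filterᵇ q S) (filterᵇ (not ∘ q) S)

  ∑-subsets-all : (xs : List X) (f : List X → ℕ) →
    ∑[ S ∈ subsets xs ] (if all q S then f S else 0) ≡ ∑ (subsets (filterᵇ q xs)) f
  ∑-subsets-all []       f = refl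
  ∑-subsets-all (x ∷ xs) f with q x in qx
  ... | true  = begin
    ∑ (subsets (x ∷ xs)) F
      ≡⟨ ∑-subsets-∷ x xs F ⟩
    ∑ (subsets xs) F + ∑[ S ∈ subsets xs ] F (x ∷ S)
      ≡⟨ cong (∑ (subsets xs) F +_) (∑-cong (subsets xs) λ S → cong (λ b → if b ∧ all q S then f (x ∷ S) else 0) qx) ⟩
    ∑ (subsets xs) F + ∑[ S ∈ subsets xs ] (if all q S then f (x ∷ S) else 0)
      ≡⟨ cong₂ _+_ (∑-subsets-all xs f) (∑-subsets-all xs (f ∘ (x ∷_))) ⟩
    ∑ (subsets (filterᵇ q xs)) f + ∑[ S ∈ subsets (filterᵇ q xs) ] f (x ∷ S)
      ≡⟨ ∑-subsets-∷ x (filterᵇ q xs) f ⟨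
    ∑ (subsets (x ∷ filterᵇ q xs)) f ∎
    where
    open ≡-Reasoning
    F : List X → ℕ
    F S = if all q S then f S else 0
  ... | false = begin
    ∑ (subsets (x ∷ xs)) F
      ≡⟨ ∑-subsets-∷ x xs F ⟩
    ∑ (subsets xs) F + ∑[ S ∈ subsets xs ] F (x ∷ S)
      ≡⟨ cong (∑ (subsets xs) F +_) (∑-cong (subsets xs) λ S → cong (λ b → if b ∧ all q S then f (x ∷ S) else 0) qx) ⟩
    ∑ (subsets xs) F + ∑[ S ∈ subsets xs ] 0
      ≡⟨ cong₂ _+_ (∑-subsets-all xs f) (∑-zero (subsets xs)) ⟩
    ∑ (subsets (filterᵇ q xs)) f + 0
      ≡⟨ +-identityʳ _ ⟩
    ∑ (subsets (filterᵇ q xs)) f ∎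
    where
    open ≡-Reasoning
    F : List X → ℕ
    F S = if all q S then f S else 0

∑-subsets-length≡C : (xs : List X) (s : ℕ) → ∑[ S ∈ subsets xs ] ⟦ length S ≡ᵇ s ⟧ ≡ length xs C s
∑-subsets-length≡C []       zero    = refl
∑-subsets-length≡C []       (suc s) = refl
∑-subsets-length≡C (x ∷ xs) s =
  trans (∑-subsets-∷ x xs (λ S → ⟦ length S ≡ᵇ s ⟧)) (pascal s)
  where
  pascal : ∀ s → ∑[ S ∈ subsets xs ] ⟦ length S ≡ᵇ s ⟧ + ∑[ S ∈ subsets xs ] ⟦ suc (length S) ≡ᵇ s ⟧
               ≡ suc (length xs) C s
  pascal zero    = cong₂ _+_ (∑-subsets-length≡C xs 0) (∑-zero (subsets xs))
  pascal (suc s) = trans (cong₂ _+_ (∑-subsets-length≡C xs (suc s)) (∑-subsets-length≡C xs s))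
    (trans (+-comm (length xs C suc s) (length xs C s)) (nCk+nC[k+1]≡[n+1]C[k+1] (length xs) s))

∑-subsets-length-cong : (xs ys : List X) → length xs ≡ length ys → (f : ℕ → ℕ) →
  ∑[ S ∈ subsets xs ] f (length S) ≡ ∑[ S ∈ subsets ys ] f (length S)
∑-subsets-length-cong []       []       _   f = refl
∑-subsets-length-cong (x ∷ xs) (y ∷ ys) |xs|≡|ys| f = begin
  ∑[ S ∈ subsets (x ∷ xs) ] f (length S)
    ≡⟨ ∑-subsets-∷ x xs (f ∘ length) ⟩
  ∑[ S ∈ subsets xs ] f (length S) + ∑[ S ∈ subsets xs ] f (suc (length S))
    ≡⟨ cong₂ _+_ (∑-subsets-length-cong xs ys eq f) (∑-subsets-length-cong xs ys eq (f ∘ suc)) ⟩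
  ∑[ S ∈ subsets ys ] f (length S) + ∑[ S ∈ subsets ys ] f (suc (length S))
    ≡⟨ ∑-subsets-∷ y ys (f ∘ length) ⟨
  ∑[ S ∈ subsets (y ∷ ys) ] f (length S) ∎
  where
  open ≡-Reasoning
  eq = suc-injective |xs|≡|ys|

C-suc-≤ : ∀ n k → n C k ≤ suc n C k
C-suc-≤ n zero    = ≤-refl
C-suc-≤ n (suc k) = subst (n C suc k ≤_) (nCk+nC[k+1]≡[n+1]C[k+1] n k) (m≤n+m _ _)

C-monoˡ-≤ : ∀ k {m n} → m ≤ n → m C k ≤ n C k
C-monoˡ-≤ k {n = zero}  z≤n = ≤-refl
C-monoˡ-≤ k {n = suc n} m≤1+n with m≤n⇒m<n∨m≡n m≤1+n
... | inj₁ m<1+n = ≤-trans (C-monoˡ-≤ k (s≤s⁻¹ m<1+n)) (C-suc-≤ n k)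
... | inj₂ refl  = ≤-refl

-- Neighbourhoods

extensionBound : (t m n D a : ℕ) → ℕ
extensionBound t m n D a = if (a ≤ᵇ m) ∧ (a ≤ᵇ t) then (n ∸ D * a) C (t ∸ a) else 0

module Neighbourhood (r : X → X → Bool) where

  adjacentToᵇ : List X → X → Bool
  adjacentToᵇ A y = any (λ a → r a y) A

  avoidsᵇ : List X → List X → Bool
  avoidsᵇ A B = all (not ∘ adjacentToᵇ A) B

  admissibleᵇ : (t m : ℕ) → List X → List X → Bool
  admissibleᵇ t m A B = avoidsᵇ A B ∧ (length A ≤ᵇ m) ∧ (length A + length B ≡ᵇ t)

  admissibleᵇ⇒ : ∀ {t m} A B → admissibleᵇ t m A B ≡ true →
                 avoidsᵇ A B ≡ true × length A ≤ m × length A + length B ≡ t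
  admissibleᵇ⇒ A B adm =
    ∧-conicalˡ (avoidsᵇ A B) _ adm ,
    ≤ᵇ⇒≤ _ _ (Equivalence.from T-≡ (∧-conicalˡ _ _ sizes)) ,
    ≡ᵇ⇒≡ _ _ (Equivalence.from T-≡ (∧-conicalʳ _ _ sizes))
    where sizes = ∧-conicalʳ (avoidsᵇ A B) _ adm

  avoidsᵇ-∷ˡ : (a : X) (A B : List X) →
               avoidsᵇ (a ∷ A) B ≡ all (not ∘ r a) B ∧ avoidsᵇ A B
  avoidsᵇ-∷ˡ a A []       = refl
  avoidsᵇ-∷ˡ a A (b ∷ B) with r a b | adjacentToᵇ A b
  ... | true  | _     = refl
  ... | false | true  = sym (∧-zeroʳ (all (not ∘ r a) B))
  ... | false | false = avoidsᵇ-∷ˡ a A B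

  count-adjacentTo-≤ : (L : List X) {D : ℕ} → (∀ a → count (r a) L ≤ D) →
                       (A : List X) → count (adjacentToᵇ A) L ≤ D * length A
  count-adjacentTo-≤ L deg []          = ≤-trans (≤-reflexive (count-false L)) z≤n
  count-adjacentTo-≤ L {D} deg (a ∷ A) = begin
    count (adjacentToᵇ (a ∷ A)) L             ≤⟨ count-∨ (r a) (adjacentToᵇ A) L ⟩
    count (r a) L + count (adjacentToᵇ A) L   ≤⟨ +-mono-≤ (deg a) (count-adjacentTo-≤ L deg A) ⟩
    D + D * length A                          ≡⟨ *-suc D (length A) ⟨
    D * length (a ∷ A)                        ∎
    where open ≤-Reasoning

  avoidsᵇ-comm : (∀ a b → r a b ≡ r b a) → (A B : List X) → avoidsᵇ A B ≡ avoidsᵇ B A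
  avoidsᵇ-comm r-sym []      B = all-const-true B
  avoidsᵇ-comm r-sym (a ∷ A) B = begin
    avoidsᵇ (a ∷ A) B                      ≡⟨ avoidsᵇ-∷ˡ a A B ⟩
    all (not ∘ r a) B ∧ avoidsᵇ A B        ≡⟨ cong₂ _∧_ (all-cong B (cong not ∘ r-sym a)) (avoidsᵇ-comm r-sym A B) ⟩
    all (λ b → not (r b a)) B ∧ avoidsᵇ B A ≡⟨ cong (_∧ avoidsᵇ B A) (not-any (λ b → r b a) B) ⟨
    avoidsᵇ B (a ∷ A)                      ∎
    where open ≡-Reasoning

  binomial≤∑admissible : ∀ {t m D} (L : List X) → (∀ a → count (r a) L ≤ D) →
    (A : List X) → (length A ≤ᵇ m) ≡ true → length A ≤ t →
    (length L ∸ D * length A) C (t ∸ length A) ≤ ∑[ B ∈ subsets L ] ⟦ admissibleᵇ t m A B ⟧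
  binomial≤∑admissible {t} {m} {D} L deg A |A|≤m |A|≤t = begin
    (length L ∸ D * length A) C s
      ≤⟨ C-monoˡ-≤ s |L|∸D|A|≤ ⟩
    count good L C s
      ≡⟨ ∑-subsets-length≡C (filterᵇ good L) s ⟨
    ∑[ B ∈ subsets (filterᵇ good L) ] ⟦ length B ≡ᵇ s ⟧
      ≡⟨ ∑-subsets-all good L _ ⟨
    ∑[ B ∈ subsets L ] (if avoidsᵇ A B then ⟦ length B ≡ᵇ s ⟧ else 0)
      ≤⟨ ∑-mono-≤ (subsets L) pointwise ⟩
    ∑[ B ∈ subsets L ] ⟦ admissibleᵇ t m A B ⟧ ∎
    where
    open ≤-Reasoning
    s = t ∸ length A
    good = not ∘ adjacentToᵇ A
    |L|∸D|A|≤ : length L ∸ D * length A ≤ count good L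
    |L|∸D|A|≤ = begin
      length L ∸ D * length A
        ≤⟨ ∸-monoʳ-≤ (length L) (count-adjacentTo-≤ L deg A) ⟩
      length L ∸ count (adjacentToᵇ A) L
        ≡⟨ cong (_∸ count (adjacentToᵇ A) L) (count+count-not (adjacentToᵇ A) L) ⟨
      count (adjacentToᵇ A) L + count good L ∸ count (adjacentToᵇ A) L
        ≡⟨ m+n∸m≡n (count (adjacentToᵇ A) L) (count good L) ⟩
      count good L ∎
    pointwise : ∀ B → (if avoidsᵇ A B then ⟦ length B ≡ᵇ s ⟧ else 0) ≤ ⟦ admissibleᵇ t m A B ⟧
    pointwise B with avoidsᵇ A B
    ... | false = z≤n
    ... | true  = ≤-reflexive (cong ⟦_⟧ (sym (trans (cong (_∧ _) |A|≤m) (≡ᵇ-shift (length B) |A|≤t))))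

  ∑extensionBound≤∑∑admissible : ∀ {t m D n} (LA LB : List X) →
    (∀ a → count (r a) LB ≤ D) → n ≤ length LB →
    ∑[ A ∈ subsets LA ] extensionBound t m n D (length A) ≤
    ∑[ A ∈ subsets LA ] ∑[ B ∈ subsets LB ] ⟦ admissibleᵇ t m A B ⟧
  ∑extensionBound≤∑∑admissible {t} {m} {D} {n} LA LB deg n≤|LB| = ∑-mono-≤ (subsets LA) bound
    where
    bound : ∀ A → extensionBound t m n D (length A) ≤ ∑[ B ∈ subsets LB ] ⟦ admissibleᵇ t m A B ⟧
    bound A = if-≤ ((length A ≤ᵇ m) ∧ (length A ≤ᵇ t)) λ cond →
      ≤-trans (C-monoˡ-≤ (t ∸ length A) (∸-monoˡ-≤ (D * length A) n≤|LB|))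
        (binomial≤∑admissible LB deg A (∧-conicalˡ _ _ cond)
          (≤ᵇ⇒≤ (length A) t (Equivalence.from T-≡ (∧-conicalʳ _ _ cond))))

-- The hypercube

isEvenᵇ : ∀ {d} → Vec Bool d → Bool
isEvenᵇ v = evenᵇ (ones v)

evenᵇ-suc : ∀ n → evenᵇ (suc n) ≡ not (evenᵇ n)
evenᵇ-suc zero    = refl
evenᵇ-suc (suc n) = trans (sym (not-involutive (evenᵇ n))) (cong not (sym (evenᵇ-suc n)))

not-xor-not : ∀ a b → not a xor not b ≡ a xor b
not-xor-not a b = begin
  not a xor not b      ≡⟨ not-distribˡ-xor a (not b) ⟨
  not (a xor not b)    ≡⟨ cong not (not-distribʳ-xor a b) ⟨
  not (not (a xor b))  ≡⟨ not-involutive (a xor b) ⟩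
  a xor b              ∎
  where open ≡-Reasoning

evenᵇ-dist : ∀ {d} (x y : Vec Bool d) → evenᵇ (dist x y) ≡ not (isEvenᵇ x xor isEvenᵇ y)
evenᵇ-dist []          []          = refl
evenᵇ-dist (false ∷ x) (false ∷ y) = evenᵇ-dist x y
evenᵇ-dist (false ∷ x) (true ∷ y)
  rewrite evenᵇ-suc (dist x y) | evenᵇ-suc (ones y) =
  cong not (trans (evenᵇ-dist x y) (not-distribʳ-xor (isEvenᵇ x) (isEvenᵇ y)))
evenᵇ-dist (true ∷ x)  (false ∷ y)
  rewrite evenᵇ-suc (dist x y) | evenᵇ-suc (ones x) =
  cong not (trans (evenᵇ-dist x y) (not-distribˡ-xor (isEvenᵇ x) (isEvenᵇ y)))
evenᵇ-dist (true ∷ x)  (true ∷ y)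
  rewrite evenᵇ-suc (ones x) | evenᵇ-suc (ones y) =
  trans (evenᵇ-dist x y) (cong not (sym (not-xor-not (isEvenᵇ x) (isEvenᵇ y))))

isEvenᵇ-≡⇒adjᵇ-false : ∀ {d} (x y : Vec Bool d) → isEvenᵇ x ≡ isEvenᵇ y → adjᵇ x y ≡ false
isEvenᵇ-≡⇒adjᵇ-false x y px≡py with dist x y ≡ᵇ 1 in dist≡1
... | false = refl
... | true  = contradiction even-1 λ ()
  where
  open ≡-Reasoning
  even-1 : false ≡ true
  even-1 = begin
    evenᵇ 1                        ≡⟨ cong evenᵇ (≡ᵇ⇒≡ (dist x y) 1 (Equivalence.from T-≡ dist≡1)) ⟨
    evenᵇ (dist x y)               ≡⟨ evenᵇ-dist x y ⟩
    not (isEvenᵇ x xor isEvenᵇ y)  ≡⟨ cong (λ p → not (p xor isEvenᵇ y)) px≡py ⟩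
    not (isEvenᵇ y xor isEvenᵇ y)  ≡⟨ cong not (xor-same (isEvenᵇ y)) ⟩
    true                           ∎

dist-comm : ∀ {d} (x y : Vec Bool d) → dist x y ≡ dist y x
dist-comm []          []          = refl
dist-comm (false ∷ x) (false ∷ y) = dist-comm x y
dist-comm (false ∷ x) (true ∷ y)  = cong suc (dist-comm x y)
dist-comm (true ∷ x)  (false ∷ y) = cong suc (dist-comm x y)
dist-comm (true ∷ x)  (true ∷ y)  = dist-comm x y

adjᵇ-comm : ∀ {d} (x y : Vec Bool d) → adjᵇ x y ≡ adjᵇ y x
adjᵇ-comm x y = cong (_≡ᵇ 1) (dist-comm x y)

length-allVertices : ∀ d → length (allVertices d) ≡ 2 ^ d
length-allVertices zero    = refl
length-allVertices (suc d) = begin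
  length (map (false ∷_) V ++ map (true ∷_) V)
    ≡⟨ length-++ (map (false ∷_) V) ⟩
  length (map (false ∷_) V) + length (map (true ∷_) V)
    ≡⟨ cong₂ _+_ (length-map (false ∷_) V) (length-map (true ∷_) V) ⟩
  length V + length V
    ≡⟨ cong₂ _+_ (length-allVertices d) (trans (length-allVertices d) (sym (+-identityʳ _))) ⟩
  2 ^ d + (2 ^ d + 0) ∎
  where
  open ≡-Reasoning
  V = allVertices d

count-allVertices-suc : ∀ {d} (p : Vec Bool (suc d) → Bool) →
  count p (allVertices (suc d)) ≡ count (p ∘ (false ∷_)) (allVertices d) + count (p ∘ (true ∷_)) (allVertices d)
count-allVertices-suc {d} p = trans (count-++ p (map (false ∷_) V) (map (true ∷_) V))
  (cong₂ _+_ (count-map p (false ∷_) V) (count-map p (true ∷_) V))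
  where V = allVertices d

count-sphere : ∀ {d} (x : Vec Bool d) k → count (λ y → dist x y ≡ᵇ k) (allVertices d) ≡ d C k
count-sphere []      zero    = refl
count-sphere []      (suc k) = refl
count-sphere {suc d} (b ∷ x) k = trans (count-allVertices-suc (λ y → dist (b ∷ x) y ≡ᵇ k)) (by-first-bit b)
  where
  V = allVertices d
  pascal : ∀ k → count (λ y → dist x y ≡ᵇ k) V + count (λ y → suc (dist x y) ≡ᵇ k) V ≡ suc d C k
  pascal zero    = cong₂ _+_ (count-sphere x 0) (count-false V)
  pascal (suc k) = trans (cong₂ _+_ (count-sphere x (suc k)) (count-sphere x k))
    (trans (+-comm (d C suc k) (d C k)) (nCk+nC[k+1]≡[n+1]C[k+1] d k))
  by-first-bit : ∀ b → count (λ y → dist (b ∷ x) (false ∷ y) ≡ᵇ k) V +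
                       count (λ y → dist (b ∷ x) (true ∷ y) ≡ᵇ k) V ≡ suc d C k
  by-first-bit false = pascal k
  by-first-bit true  = trans (+-comm (count (λ y → suc (dist x y) ≡ᵇ k) V) _) (pascal k)

degree : ∀ {d} (x : Vec Bool d) → count (adjᵇ x) (allVertices d) ≡ d
degree {d} x = trans (count-sphere x 1) (nC1≡n d)

oddVertices : (d : ℕ) → List (Vec Bool d)
oddVertices d = filterᵇ (not ∘ isEvenᵇ) (allVertices d)

length-evenVertices : ∀ d → length (evenVertices (suc d)) ≡ 2 ^ d
length-evenVertices d = begin
  count isEvenᵇ (allVertices (suc d))
    ≡⟨ count-allVertices-suc {d} isEvenᵇ ⟩
  count isEvenᵇ V + count (isEvenᵇ ∘ (true ∷_)) V
    ≡⟨ cong (count isEvenᵇ V +_) (count-cong V (evenᵇ-suc ∘ ones)) ⟩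
  count isEvenᵇ V + count (not ∘ isEvenᵇ) V
    ≡⟨ count+count-not isEvenᵇ V ⟩
  length V
    ≡⟨ length-allVertices d ⟩
  2 ^ d ∎
  where
  open ≡-Reasoning
  V = allVertices d

length-oddVertices : ∀ d → length (oddVertices (suc d)) ≡ 2 ^ d
length-oddVertices d = begin
  count (not ∘ isEvenᵇ) (allVertices (suc d))
    ≡⟨ count-allVertices-suc {d} (not ∘ isEvenᵇ) ⟩
  count (not ∘ isEvenᵇ) V + count (not ∘ isEvenᵇ ∘ (true ∷_)) V
    ≡⟨ cong (count (not ∘ isEvenᵇ) V +_) (count-cong V λ y → trans (cong not (evenᵇ-suc (ones y))) (not-involutive _)) ⟩
  count (not ∘ isEvenᵇ) V + count isEvenᵇ V
    ≡⟨ +-comm (count (not ∘ isEvenᵇ) V) _ ⟩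
  count isEvenᵇ V + count (not ∘ isEvenᵇ) V
    ≡⟨ count+count-not isEvenᵇ V ⟩
  length V
    ≡⟨ length-allVertices d ⟩
  2 ^ d ∎
  where
  open ≡-Reasoning
  V = allVertices d

degree-filterᵇ-≤ : ∀ {d} (side : Vec Bool d → Bool) (x : Vec Bool d) →
                   count (adjᵇ x) (filterᵇ side (allVertices d)) ≤ d
degree-filterᵇ-≤ {d} side x = ≤-trans (count-filterᵇ-≤ (adjᵇ x) side (allVertices d)) (≤-reflexive (degree x))

-- Independent sets of the cube

module Hypercube {d : ℕ} where
  open Neighbourhood (adjᵇ {d}) public

  even odd : List (Vec Bool d) → List (Vec Bool d)
  even = filterᵇ isEvenᵇ
  odd  = filterᵇ (not ∘ isEvenᵇ)

  independentᵇ-bipartite : (S : List (Vec Bool d)) →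
    avoidsᵇ (even S) (odd S) ≡ true → independentᵇ S ≡ true
  independentᵇ-bipartite []      _  = refl
  independentᵇ-bipartite (x ∷ S) av with isEvenᵇ x in x-even
  ... | true  = cong₂ _∧_ (cong not isolated) (independentᵇ-bipartite S (∧-conicalʳ _ _ av′))
    where
    av′ : (all (not ∘ adjᵇ x) (odd S) ∧ avoidsᵇ (even S) (odd S)) ≡ true
    av′ = trans (sym (avoidsᵇ-∷ˡ x (even S) (odd S))) av
    isolated : any (adjᵇ x) S ≡ false
    isolated = any≡false-by-filterᵇ (not ∘ isEvenᵇ) (adjᵇ x)
      (λ y y-even → isEvenᵇ-≡⇒adjᵇ-false x y (trans x-even (sym (not-injective y-even))))
      S (∧-conicalˡ _ _ av′)
  ... | false = cong₂ _∧_ (cong not isolated)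
      (independentᵇ-bipartite S (trans (avoidsᵇ-comm adjᵇ-comm (even S) (odd S)) (∧-conicalʳ _ _ av′)))
    where
    av′ : (all (not ∘ adjᵇ x) (even S) ∧ avoidsᵇ (odd S) (even S)) ≡ true
    av′ = trans (sym (avoidsᵇ-∷ˡ x (odd S) (even S)))
                (trans (sym (avoidsᵇ-comm adjᵇ-comm (even S) (x ∷ odd S))) av)
    isolated : any (adjᵇ x) S ≡ false
    isolated = any≡false-by-filterᵇ isEvenᵇ (adjᵇ x)
      (λ y y-odd → isEvenᵇ-≡⇒adjᵇ-false x y (trans x-even (sym y-odd)))
      S (∧-conicalˡ _ _ av′)

  admissible-pair≤ : ∀ {t m} → 2 * m < t → (S : List (Vec Bool d)) →
    ⟦ admissibleᵇ t m (even S) (odd S) ⟧ + ⟦ admissibleᵇ t m (odd S) (even S) ⟧ ≤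
    ⟦ (length S ≡ᵇ t) ∧ independentᵇ S ⟧
  admissible-pair≤ {t} {m} 2m<t S = ⟦⟧+⟦⟧≤⟦⟧ not-both from-even from-odd
    where
    Goal = ((length S ≡ᵇ t) ∧ independentᵇ S) ≡ true
    sized-independent : length (even S) + length (odd S) ≡ t → avoidsᵇ (even S) (odd S) ≡ true → Goal
    sized-independent size av = cong₂ _∧_
      (Equivalence.to T-≡ (≡⇒≡ᵇ (length S) t (trans (sym (count+count-not isEvenᵇ S)) size)))
      (independentᵇ-bipartite S av)
    from-even : admissibleᵇ t m (even S) (odd S) ≡ true → Goal
    from-even adm with admissibleᵇ⇒ (even S) (odd S) adm
    ... | av , _ , size = sized-independent size av
    from-odd : admissibleᵇ t m (odd S) (even S) ≡ true → Goal
    from-odd adm with admissibleᵇ⇒ (odd S) (even S) adm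
    ... | av , _ , size = sized-independent (trans (+-comm (length (even S)) _) size)
                                            (trans (avoidsᵇ-comm adjᵇ-comm (even S) (odd S)) av)
    not-both : admissibleᵇ t m (even S) (odd S) ≡ true → admissibleᵇ t m (odd S) (even S) ≡ true → ⊥
    not-both adm adm′ with admissibleᵇ⇒ (even S) (odd S) adm | admissibleᵇ⇒ (odd S) (even S) adm′
    ... | _ , |even|≤m , size | _ , |odd|≤m , _ = <⇒≱ 2m<t (begin
      t                                 ≡⟨ size ⟨
      length (even S) + length (odd S)  ≤⟨ +-mono-≤ |even|≤m |odd|≤m ⟩
      m + m                             ≡⟨ cong (m +_) (+-identityʳ m) ⟨
      2 * m                             ∎)
      where open ≤-Reasoning

  ∑∑admissible≤iₜ : ∀ {t m} → 2 * m < t →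
    ∑[ A ∈ subsets (evenVertices d) ] ∑[ B ∈ subsets (oddVertices d) ] ⟦ admissibleᵇ t m A B ⟧ +
    ∑[ B ∈ subsets (oddVertices d) ] ∑[ A ∈ subsets (evenVertices d) ] ⟦ admissibleᵇ t m B A ⟧ ≤
    iₜ d t
  ∑∑admissible≤iₜ {t} {m} 2m<t = begin
    ∑[ A ∈ subsets ℰ ] ∑[ B ∈ subsets 𝒪 ] ⟦ admissibleᵇ t m A B ⟧ +
    ∑[ B ∈ subsets 𝒪 ] ∑[ A ∈ subsets ℰ ] ⟦ admissibleᵇ t m B A ⟧
      ≡⟨ cong (∑[ A ∈ subsets ℰ ] ∑[ B ∈ subsets 𝒪 ] ⟦ admissibleᵇ t m A B ⟧ +_)
              (∑-comm (subsets 𝒪) (subsets ℰ) (λ B A → ⟦ admissibleᵇ t m B A ⟧)) ⟩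
    ∑[ A ∈ subsets ℰ ] ∑[ B ∈ subsets 𝒪 ] ⟦ admissibleᵇ t m A B ⟧ +
    ∑[ A ∈ subsets ℰ ] ∑[ B ∈ subsets 𝒪 ] ⟦ admissibleᵇ t m B A ⟧
      ≡⟨ trans (∑-cong (subsets ℰ) λ A → ∑-distrib-+ (subsets 𝒪) _ _) (∑-distrib-+ (subsets ℰ) _ _) ⟨
    ∑[ A ∈ subsets ℰ ] ∑[ B ∈ subsets 𝒪 ] (⟦ admissibleᵇ t m A B ⟧ + ⟦ admissibleᵇ t m B A ⟧)
      ≡⟨ ∑-subsets-partition isEvenᵇ V (λ A B → ⟦ admissibleᵇ t m A B ⟧ + ⟦ admissibleᵇ t m B A ⟧) ⟨
    ∑[ S ∈ subsets V ] (⟦ admissibleᵇ t m (even S) (odd S) ⟧ + ⟦ admissibleᵇ t m (odd S) (even S) ⟧)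
      ≤⟨ ∑-mono-≤ (subsets V) (admissible-pair≤ 2m<t) ⟩
    ∑[ S ∈ subsets V ] ⟦ (length S ≡ᵇ t) ∧ independentᵇ S ⟧
      ≡⟨ count≡∑ _ (subsets V) ⟨
    iₜ d t ∎
    where
    open ≤-Reasoning
    V = allVertices d
    ℰ = evenVertices d
    𝒪 = oddVertices d

sumTerm≤∑extensionBound : ∀ d t m →
  sumTerm d t m ≤ ∑[ A ∈ subsets (evenVertices d) ] extensionBound t m (N d) d (length A)
sumTerm≤∑extensionBound d t m = begin
  sumTerm d t m
    ≡⟨ ∑-filterᵇ (λ A → clLe1ᵇ A ∧ (length A ≤ᵇ m)) (subsets (evenVertices d)) (binomTerm d t ∘ length) ⟩
  ∑[ A ∈ subsets (evenVertices d) ] (if clLe1ᵇ A ∧ (length A ≤ᵇ m) then binomTerm d t (length A) else 0)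
    ≤⟨ ∑-mono-≤ (subsets (evenVertices d)) drop-conditions ⟩
  ∑[ A ∈ subsets (evenVertices d) ] extensionBound t m (N d) d (length A) ∎
  where
  open ≤-Reasoning
  drop-conditions : ∀ A → (if clLe1ᵇ A ∧ (length A ≤ᵇ m) then binomTerm d t (length A) else 0) ≤
                          extensionBound t m (N d) d (length A)
  drop-conditions A =
    if-≤ (clLe1ᵇ A ∧ (length A ≤ᵇ m)) λ cl∧small →
    if-≤ ((length A ≤ᵇ t) ∧ (d * length A ≤ᵇ N d)) λ fits →
    ≤-if (cong₂ _∧_ (∧-conicalʳ (clLe1ᵇ A) _ cl∧small) (∧-conicalˡ (length A ≤ᵇ t) _ fits))

2*sumTerm≤iₜ : ∀ k t m → 2 * m < t → 2 * sumTerm (suc k) t m ≤ iₜ (suc k) t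
2*sumTerm≤iₜ k t m 2m<t = begin
  2 * sumTerm d t m
    ≡⟨ cong (sumTerm d t m +_) (+-identityʳ _) ⟩
  sumTerm d t m + sumTerm d t m
    ≤⟨ +-mono-≤ (sumTerm≤∑extensionBound d t m) (sumTerm≤∑extensionBound d t m) ⟩
  ∑[ A ∈ subsets ℰ ] g (length A) + ∑[ A ∈ subsets ℰ ] g (length A)
    ≡⟨ cong (∑[ A ∈ subsets ℰ ] g (length A) +_)
            (∑-subsets-length-cong ℰ 𝒪 (trans (length-evenVertices k) (sym (length-oddVertices k))) g) ⟩
  ∑[ A ∈ subsets ℰ ] g (length A) + ∑[ B ∈ subsets 𝒪 ] g (length B)
    ≤⟨ +-mono-≤
         (∑extensionBound≤∑∑admissible ℰ 𝒪 (degree-filterᵇ-≤ _) (≤-reflexive (sym (length-oddVertices k))))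
         (∑extensionBound≤∑∑admissible 𝒪 ℰ (degree-filterᵇ-≤ _) (≤-reflexive (sym (length-evenVertices k)))) ⟩
  ∑[ A ∈ subsets ℰ ] ∑[ B ∈ subsets 𝒪 ] ⟦ admissibleᵇ t m A B ⟧ +
  ∑[ B ∈ subsets 𝒪 ] ∑[ A ∈ subsets ℰ ] ⟦ admissibleᵇ t m B A ⟧
    ≤⟨ ∑∑admissible≤iₜ 2m<t ⟩
  iₜ d t ∎
  where
  open ≤-Reasoning
  open Hypercube {suc k}
  d = suc k
  ℰ = evenVertices d
  𝒪 = oddVertices d
  g : ℕ → ℕ
  g = extensionBound t m (N d) d

-- Estimates

eNum≤3*n! : ∀ n → eNum n ≤ 3 * n !
eNum≤3*n! 0 = s≤s z≤n
eNum≤3*n! 1 = s≤s (s≤s z≤n)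
eNum≤3*n! (suc (suc n)) = ≤-trans (m≤m+n _ 1) (eNum+1≤3*n! n)
  where
  eNum+1≤3*n! : ∀ n → eNum (2 + n) + 1 ≤ 3 * (2 + n) !
  eNum+1≤3*n! zero    = ≤-refl
  eNum+1≤3*n! (suc n) = begin
    (3 + n) * e + 1 + 1             ≡⟨ +-assoc ((3 + n) * e) 1 1 ⟩
    (3 + n) * e + 2                 ≤⟨ +-monoʳ-≤ ((3 + n) * e) (s≤s (s≤s z≤n)) ⟩
    (3 + n) * e + (3 + n)           ≡⟨ factor (3 + n) e ⟩
    (3 + n) * (e + 1)               ≤⟨ *-monoʳ-≤ (3 + n) (eNum+1≤3*n! n) ⟩
    (3 + n) * (3 * (2 + n) !)       ≡⟨ x∙yz≈y∙xz (3 + n) 3 ((2 + n) !) ⟩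
    3 * (3 + n) !                   ∎
    where
    open ≤-Reasoning
    e = eNum (2 + n)
    factor : ∀ a x → a * x + a ≡ a * (x + 1)
    factor = solve-∀

-- (1 - x)^k (1 + kx) ≤ 1 for x = t/(u + t), cleared of denominators.
bernoulli : ∀ u t k → u ^ k * (u + t + k * t) ≤ (u + t) ^ k * (u + t)
bernoulli u t zero    = ≤-reflexive (cong (1 *_) (+-identityʳ (u + t)))
bernoulli u t (suc k) = begin
  u * u ^ k * (u + t + suc k * t)        ≡⟨ xy∙z≈y∙xz u (u ^ k) (u + t + suc k * t) ⟩
  u ^ k * (u * (u + t + suc k * t))      ≤⟨ *-monoʳ-≤ (u ^ k) (≤-trans (m≤m+n _ _) (≤-reflexive (expand u t k))) ⟩
  u ^ k * ((u + t) * (u + t + k * t))    ≡⟨ x∙yz≈y∙xz (u ^ k) (u + t) (u + t + k * t) ⟩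
  (u + t) * (u ^ k * (u + t + k * t))    ≤⟨ *-monoʳ-≤ (u + t) (bernoulli u t k) ⟩
  (u + t) * ((u + t) ^ k * (u + t))      ≡⟨ *-assoc (u + t) _ _ ⟨
  (u + t) * (u + t) ^ k * (u + t)        ∎
  where
  open ≤-Reasoning
  expand : ∀ u t k → u * (u + t + suc k * t) + suc k * t * t ≡ (u + t) * (u + t + k * t)
  expand = solve-∀

n*n≤2^n : ∀ n → 4 ≤ n → n * n ≤ 2 ^ n
n*n≤2^n n 4≤n with m≤n⇒∃[o]m+o≡n 4≤n
... | j , refl = go j
  where
  go : ∀ j → (4 + j) * (4 + j) ≤ 2 ^ (4 + j)
  go zero    = ≤-refl
  go (suc j) = begin
    (5 + j) * (5 + j)                           ≤⟨ m≤m+n _ _ ⟩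
    (5 + j) * (5 + j) + (7 + 6 * j + j * j)     ≡⟨ double-square j ⟩
    (4 + j) * (4 + j) + ((4 + j) * (4 + j) + 0) ≤⟨ +-mono-≤ (go j) (+-monoˡ-≤ 0 (go j)) ⟩
    2 ^ (4 + j) + (2 ^ (4 + j) + 0)             ∎
    where
    open ≤-Reasoning
    double-square : ∀ j → (5 + j) * (5 + j) + (7 + 6 * j + j * j) ≡ (4 + j) * (4 + j) + ((4 + j) * (4 + j) + 0)
    double-square = solve-∀

^-distribʳ-* : ∀ m n k → (m * n) ^ k ≡ m ^ k * n ^ k
^-distribʳ-* m n zero    = refl
^-distribʳ-* m n (suc k) = trans (cong (m * n *_) (^-distribʳ-* m n k)) (*-interchange m n (m ^ k) (n ^ k))

^-cancelʳ-≤ : ∀ k .{{_ : NonZero k}} {m n} → m ^ k ≤ n ^ k → m ≤ n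
^-cancelʳ-≤ k {m} {n} mᵏ≤nᵏ with m ≤? n
... | yes m≤n = m≤n
... | no  m≰n = contradiction mᵏ≤nᵏ (<⇒≱ (^-monoˡ-< k (≰⇒> m≰n)))

linear-lower-bound : ∀ {p q K k t N} → 1 ≤ p → 1 ≤ q → 1 ≤ k → 2 * (q * K) ^ 3 ≤ k →
                     (p * N) ^ 3 ≤ (q * t) ^ 3 * suc k → K * N ≤ k * t
linear-lower-bound {p} {q} {K} {k} {t} {N} 1≤p 1≤q 1≤k 2M³≤k hyp = begin
  K * N         ≤⟨ *-monoʳ-≤ K (m≤n*m N p {{>-nonZero 1≤p}}) ⟩
  K * (p * N)   ≤⟨ *-cancelˡ-≤ q {{>-nonZero 1≤q}} qKpN≤qkt ⟩
  k * t         ∎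
  where
  open ≤-Reasoning
  M = q * K
  M³[1+k]≤k³ : M ^ 3 * suc k ≤ k ^ 3
  M³[1+k]≤k³ = begin
    M ^ 3 * suc k    ≤⟨ *-monoʳ-≤ (M ^ 3) (+-monoˡ-≤ k 1≤k) ⟩
    M ^ 3 * (k + k)  ≡⟨ doubling (M ^ 3) k ⟩
    2 * M ^ 3 * k    ≤⟨ *-monoˡ-≤ k 2M³≤k ⟩
    k * k            ≤⟨ *-monoʳ-≤ k (m≤m*n k k {{>-nonZero 1≤k}}) ⟩
    k * (k * k)      ≡⟨ cong (λ x → k * (k * x)) (*-identityʳ k) ⟨
    k ^ 3            ∎
    where
    doubling : ∀ x k → x * (k + k) ≡ 2 * x * k
    doubling = solve-∀
  cube≤ : (M * (p * N)) ^ 3 ≤ (k * (q * t)) ^ 3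
  cube≤ = begin
    (M * (p * N)) ^ 3              ≡⟨ ^-distribʳ-* M (p * N) 3 ⟩
    M ^ 3 * (p * N) ^ 3            ≤⟨ *-monoʳ-≤ (M ^ 3) hyp ⟩
    M ^ 3 * ((q * t) ^ 3 * suc k)  ≡⟨ x∙yz≈xz∙y (M ^ 3) ((q * t) ^ 3) (suc k) ⟩
    M ^ 3 * suc k * (q * t) ^ 3    ≤⟨ *-monoˡ-≤ ((q * t) ^ 3) M³[1+k]≤k³ ⟩
    k ^ 3 * (q * t) ^ 3            ≡⟨ ^-distribʳ-* k (q * t) 3 ⟨
    (k * (q * t)) ^ 3              ∎
  qKpN≤qkt : q * (K * (p * N)) ≤ q * (k * t)
  qKpN≤qkt = begin
    q * (K * (p * N))  ≡⟨ *-assoc q K (p * N) ⟨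
    M * (p * N)        ≤⟨ ^-cancelʳ-≤ 3 cube≤ ⟩
    k * (q * t)        ≡⟨ x∙yz≈y∙xz k q t ⟩
    q * (k * t)        ∎

2[1+k]<t : ∀ {K k t} → 5 ≤ K → 4 ≤ k → K * 2 ^ k ≤ k * t → 2 * suc k < t
2[1+k]<t {K} {k@(suc j)} {t} 5≤K 4≤k hyp = <-≤-trans 2[1+k]<5k 5k≤t
  where
  open ≤-Reasoning
  2[1+k]<5k : 2 * suc k < 5 * k
  2[1+k]<5k = ≤-trans (m≤m+n _ (3 * j)) (≤-reflexive (spread j))
    where
    spread : ∀ j → suc (2 * suc (suc j)) + 3 * j ≡ 5 * suc j
    spread = solve-∀
  5k≤t : 5 * k ≤ t
  5k≤t = *-cancelˡ-≤ k (begin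
    k * (5 * k)    ≡⟨ x∙yz≈y∙xz k 5 k ⟩
    5 * (k * k)    ≤⟨ *-mono-≤ 5≤K (n*n≤2^n k 4≤k) ⟩
    K * 2 ^ k      ≤⟨ hyp ⟩
    k * t          ∎)

e-term-bound : ∀ c N k t m n .{{c≢0 : NonZero c}} .{{N≢0 : NonZero N}} →
               m * n ! * N ^ k ≤ c * t * (N ∸ t) ^ k * eNum n → t ≤ N →
               12 * c * N ≤ k * t → 4 * m ≤ t
e-term-bound c N k t m n hyp t≤N 12cN≤kt = *-cancelʳ-≤ (4 * m) t (3 * c * N) (begin
  4 * m * (3 * c * N)  ≡⟨ regroup m c N ⟩
  m * (12 * c * N)     ≤⟨ *-monoʳ-≤ m (≤-trans 12cN≤kt (m≤n+m (k * t) N)) ⟩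
  m * (N + k * t)      ≤⟨ m[N+kt]≤3ctN ⟩
  3 * c * t * N        ≡⟨ regroup′ c t N ⟩
  t * (3 * c * N)      ∎)
  where
  open ≤-Reasoning
  Q = (N ∸ t) ^ k
  instance
    _ : NonZero (N ^ k)
    _ = m^n≢0 N k
    _ : NonZero (n !)
    _ = n !≢0
    _ : NonZero (3 * c * N)
    _ = m*n≢0 (3 * c) N {{m*n≢0 3 c}}
  regroup : ∀ m c N → 4 * m * (3 * c * N) ≡ m * (12 * c * N)
  regroup = solve-∀
  regroup′ : ∀ c t N → 3 * c * t * N ≡ t * (3 * c * N)
  regroup′ = solve-∀
  mNᵏ≤3ctQ : m * N ^ k ≤ 3 * c * t * Q
  mNᵏ≤3ctQ = *-cancelʳ-≤ (m * N ^ k) (3 * c * t * Q) (n !) (begin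
    m * N ^ k * n !        ≡⟨ xy∙z≈xz∙y m (N ^ k) (n !) ⟩
    m * n ! * N ^ k        ≤⟨ hyp ⟩
    c * t * Q * eNum n     ≤⟨ *-monoʳ-≤ (c * t * Q) (eNum≤3*n! n) ⟩
    c * t * Q * (3 * n !)  ≡⟨ pull-3 c t Q (n !) ⟩
    3 * c * t * Q * n !    ∎)
    where
    pull-3 : ∀ c t Q f → c * t * Q * (3 * f) ≡ 3 * c * t * Q * f
    pull-3 = solve-∀
  Q[N+kt]≤Nᵏ⁺¹ : Q * (N + k * t) ≤ N ^ k * N
  Q[N+kt]≤Nᵏ⁺¹ = subst (λ x → Q * (x + k * t) ≤ x ^ k * x) (m∸n+n≡m t≤N) (bernoulli (N ∸ t) t k)
  m[N+kt]≤3ctN : m * (N + k * t) ≤ 3 * c * t * N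
  m[N+kt]≤3ctN = *-cancelʳ-≤ (m * (N + k * t)) (3 * c * t * N) (N ^ k) (begin
    m * (N + k * t) * N ^ k        ≡⟨ xy∙z≈xz∙y m (N + k * t) (N ^ k) ⟩
    m * N ^ k * (N + k * t)        ≤⟨ *-monoˡ-≤ (N + k * t) mNᵏ≤3ctQ ⟩
    3 * c * t * Q * (N + k * t)    ≡⟨ *-assoc (3 * c * t) Q (N + k * t) ⟩
    3 * c * t * (Q * (N + k * t))  ≤⟨ *-monoʳ-≤ (3 * c * t) Q[N+kt]≤Nᵏ⁺¹ ⟩
    3 * c * t * (N ^ k * N)        ≡⟨ x∙yz≈xz∙y (3 * c * t) (N ^ k) N ⟩
    3 * c * t * N * N ^ k          ∎)

2*m<t : ∀ {m t} → 0 < t → 4 * m ≤ t → 2 * m < t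
2*m<t {zero}  0<t _    = 0<t
2*m<t {suc m} _   4m≤t = <-≤-trans (*-monoˡ-< (suc m) {2} {4} (s≤s (s≤s (s≤s z≤n)))) 4m≤t

-- 12 = 4 · 3, with 3 > e and the 4 giving ⌊f⌋ ≤ t/4.
K : ℕ
K = 12 * 5 ^ 7

LeF⇒2*m<t : ∀ {p q k t m} → 0 < p → 0 < q → 4 + 2 * (q * K) ^ 3 ≤ k →
            LowerBound p q (suc k) t → 4 * t ≤ 3 * N (suc k) → LeF (suc k) t m → 2 * m < t
LeF⇒2*m<t {p} {q} {k} {t} {m} 0<p 0<q 4+2M³≤k lower 4t≤3N = 2*m<t-from
  where
  4≤k : 4 ≤ k
  4≤k = ≤-trans (m≤m+n 4 _) 4+2M³≤k
  -- log₂ d > 1, so the lower bound applies to the rational 1/1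
  cube-bound : (p * 2 ^ k) ^ 3 ≤ (q * t) ^ 3 * suc k
  cube-bound = subst₂ (λ p′ q′ → (p′ * 2 ^ k) ^ 3 ≤ (q′ * t) ^ 3 * suc k) (*-identityʳ p) (*-identityʳ q)
    (lower 1 1 z<s (subst (2 <_) (sym (*-identityʳ (suc k))) (s≤s (≤-trans (s≤s (s≤s z≤n)) 4≤k))))
  K2ᵏ≤kt : K * 2 ^ k ≤ k * t
  K2ᵏ≤kt = linear-lower-bound 0<p 0<q (≤-trans (s≤s z≤n) 4≤k) (≤-trans (m≤n+m _ 4) 4+2M³≤k) cube-bound
  t≤2ᵏ : t ≤ 2 ^ k
  t≤2ᵏ = *-cancelˡ-≤ 4 (≤-trans 4t≤3N (*-monoˡ-≤ (2 ^ k) (n≤1+n 3)))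
  2d<t : 2 * suc k < t
  2d<t = 2[1+k]<t (≤ᵇ⇒≤ 5 K _) 4≤k K2ᵏ≤kt
  2*m<t-from : LeF (suc k) t m → 2 * m < t
  2*m<t-from (inj₁ m≤d)          = ≤-<-trans (*-monoʳ-≤ 2 m≤d) 2d<t
  2*m<t-from (inj₂ (n , e-term)) = 2*m<t {m} (≤-<-trans z≤n 2d<t)
    (e-term-bound (5 ^ 7) (2 ^ k) k t m n {{N≢0 = m^n≢0 2 k}} e-term t≤2ᵏ K2ᵏ≤kt)

lemma3p2 : (p q : ℕ) → 0 < p → 0 < q →
           ∃[ d₀ ] ((d : ℕ) → d₀ ≤ d → (t : ℕ) →
             LowerBound p q d t → 4 * t ≤ 3 * N d →
             (m : ℕ) → IsFloorF d t m →
             2 * sumTerm d t m ≤ iₜ d t)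
lemma3p2 p q 0<p 0<q = 5 + 2 * (q * K) ^ 3 , λ where
  (suc k) (s≤s 4+2M³≤k) t lower 4t≤3N m (m≤f , _) →
    2*sumTerm≤iₜ k t m (LeF⇒2*m<t 0<p 0<q 4+2M³≤k lower 4t≤3N m≤f)
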